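{- Let $G$ be a $j$-$2$-$k$ graph with degree-3 vertices $L$ (left) and $R$ (right), and primary edges numbered as follows: edge 1 is the edge of the upper ($j$-edge) path at $L$, edge 2 the edge of the lower ($k$-edge) path at $L$, edge 3 the edge of the middle path at $L$, edge 4 the edge of the middle path at $R$, edge 5 the edge of the lower path at $R$, edge 6 the edge of the upper path at $R$. Consider the following five configurations: (A) edges 1 and 2 point into $L$, and edges 5 and 6 point out of $R$; (B) edges 1 and 3 point into $L$, and edge 6 points out of $R$; (C) edges 1 and 3 point into $L$, and edge 5 points out of $R$; (D) edges 1 and 3 point out of $L$, and edge 6 points into $R$; (E) edges 1 and 3 point out of $L$, and edge 5 points into $R$. Consider any orientation of a subset of the edges of $G$ in which no vertex is a sink or a source, no undirected edge can be directed in either direction without creating a sink or a source, and the primary edges named in one of the configurations (A)–(E) are directed as that configuration prescribes. Then the number of undirected edges of $G$ is even.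
   Context: A $j$-$2$-$k$ graph consists of two vertices $L$ and $R$ joined by three internally disjoint paths: an upper path with $j$ edges, a middle path with $2$ edges, and a lower path with $k$ edges ($j,k\ge1$, not both equal to $1$, so that the graph is simple); all vertices other than $L,R$ have degree $2$. It is drawn in the plane with the middle path between the upper and lower paths. A vertex is a sink if all edges incident to it are directed into it, and a source if all edges incident to it are directed out of it. -}

module Defs where

open import Data.Nat using (ℕ; zero; suc; _≤_; _<_; _≟_)
open import Data.Fin using (Fin; zero; suc; toℕ; fromℕ)
open import Data.List using (List; _++_; map; filter; length; allFin)
open import Data.Product using (Σ; _×_; _,_)
open import Data.Sum using (_⊎_)
open import Data.Unit using (⊤)
open import Relation.Nullary using (yes; no; ¬_; Dec)
open import Relation.Binary.PropositionalEquality using (_≡_; _≢_; refl)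

-- Vertices: L, R, the middle vertex `mid`, internal upper-path vertices
-- upV p (1 ≤ p < j, p = distance from L along the upper path) and
-- internal lower-path vertices lowV p (1 ≤ p < k).

data Vtx : Set where
  L R mid : Vtx
  upV lowV : ℕ → Vtx

IsVertex : ℕ → ℕ → Vtx → Set
IsVertex j k L = ⊤
IsVertex j k R = ⊤
IsVertex j k mid = ⊤
IsVertex j k (upV p) = (1 ≤ p) × (p < j)
IsVertex j k (lowV p) = (1 ≤ p) × (p < k)

-- Edges: upE i is the (i+1)-th edge of the upper path counted from L,
-- midE 0 / midE 1 are the middle-path edges at L / at R,
-- lowE i is the (i+1)-th edge of the lower path counted from L.
data Edge (j k : ℕ) : Set where
  upE  : Fin j → Edge j k
  midE : Fin 2 → Edge j k
  lowE : Fin k → Edge j k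

allEdges : (j k : ℕ) → List (Edge j k)
allEdges j k = map upE (allFin j) ++ (map midE (allFin 2) ++ map lowE (allFin k))

upPos : ℕ → ℕ → Vtx
upPos n zero = L
upPos n (suc p) with suc p ≟ n
... | yes _ = R
... | no _  = upV (suc p)

lowPos : ℕ → ℕ → Vtx
lowPos n zero = L
lowPos n (suc p) with suc p ≟ n
... | yes _ = R
... | no _  = lowV (suc p)

-- Endpoints of each edge, listed in the L-to-R direction along its path.
tailV : {j k : ℕ} → Edge j k → Vtx
tailV {j} {k} (upE i) = upPos j (toℕ i)
tailV (midE zero) = L
tailV (midE (suc _)) = mid
tailV {j} {k} (lowE i) = lowPos k (toℕ i)

headV : {j k : ℕ} → Edge j k → Vtx
headV {j} {k} (upE i) = upPos j (suc (toℕ i))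
headV (midE zero) = mid
headV (midE (suc _)) = R
headV {j} {k} (lowE i) = lowPos k (suc (toℕ i))

-- Partial orientations: each edge is undirected, directed forward
-- (tailV → headV) or directed backward (headV → tailV).

data Dir : Set where
  undir fwd bwd : Dir

Orientation : ℕ → ℕ → Set
Orientation j k = Edge j k → Dir

Incident : {j k : ℕ} → Edge j k → Vtx → Set
Incident e v = (headV e ≡ v) ⊎ (tailV e ≡ v)

Into : {j k : ℕ} → Orientation j k → Edge j k → Vtx → Set
Into o e v = ((o e ≡ fwd) × (headV e ≡ v)) ⊎ ((o e ≡ bwd) × (tailV e ≡ v))

OutOf : {j k : ℕ} → Orientation j k → Edge j k → Vtx → Set
OutOf o e v = ((o e ≡ fwd) × (tailV e ≡ v)) ⊎ ((o e ≡ bwd) × (headV e ≡ v))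

Sink : {j k : ℕ} → Orientation j k → Vtx → Set
Sink {j} {k} o v = (e : Edge j k) → Incident e v → Into o e v

Source : {j k : ℕ} → Orientation j k → Vtx → Set
Source {j} {k} o v = (e : Edge j k) → Incident e v → OutOf o e v

HasSinkOrSource : {j k : ℕ} → Orientation j k → Set
HasSinkOrSource {j} {k} o =
  Σ Vtx (λ v → IsVertex j k v × (Sink o v ⊎ Source o v))

NoSinkNoSource : {j k : ℕ} → Orientation j k → Set
NoSinkNoSource o = ¬ HasSinkOrSource o

UpdatedAt : {j k : ℕ} → Orientation j k → Edge j k → Dir → Orientation j k → Set
UpdatedAt {j} {k} o e d o' = (o' e ≡ d) × ((e' : Edge j k) → e' ≢ e → o' e' ≡ o e')

Maximal : {j k : ℕ} → Orientation j k → Set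
Maximal {j} {k} o = (e : Edge j k) → o e ≡ undir →
  ((o' : Orientation j k) → UpdatedAt o e fwd o' → HasSinkOrSource o') ×
  ((o' : Orientation j k) → UpdatedAt o e bwd o' → HasSinkOrSource o')

isUndir : (d : Dir) → Dec (d ≡ undir)
isUndir undir = yes refl
isUndir fwd = no (λ ())
isUndir bwd = no (λ ())

numUndirected : {j k : ℕ} → Orientation j k → ℕ
numUndirected {j} {k} o = length (filter (λ e → isUndir (o e)) (allEdges j k))

module Primary (j' k' : ℕ) where
  G : Set
  G = Edge (suc j') (suc k')
  e1 e2 e3 e4 e5 e6 : G
  e1 = upE zero
  e2 = lowE zero
  e3 = midE zero
  e4 = midE (suc zero)
  e5 = lowE (fromℕ k')
  e6 = upE (fromℕ j')

  ConfigA ConfigB ConfigC ConfigD ConfigE : Orientation (suc j') (suc k') → Set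
  ConfigA o = Into o e1 L × Into o e2 L × OutOf o e5 R × OutOf o e6 R
  ConfigB o = Into o e1 L × Into o e3 L × OutOf o e6 R
  ConfigC o = Into o e1 L × Into o e3 L × OutOf o e5 R
  ConfigD o = OutOf o e1 L × OutOf o e3 L × Into o e6 R
  ConfigE o = OutOf o e1 L × OutOf o e3 L × Into o e5 R

  SomeConfig : Orientation (suc j') (suc k') → Set
  SomeConfig o = ConfigA o ⊎ ConfigB o ⊎ ConfigC o ⊎ ConfigD o ⊎ ConfigE o

module Submission where

-- Read each of the three paths between L and R from L to R.  Along a path, two
-- consecutive directed edges point the same way (otherwise their common vertex
-- is a sink or a source), while maximality forces the two neighbours of an
-- undirected edge to point opposite ways.  So the direction flips exactly at the
-- undirected edges, and their number on a path is odd iff the first and the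
-- last edge point different ways, where an undirected end edge counts as
-- pointing against its neighbour.  In each configuration these effective end
-- directions are, both at L and at R, two backward and one forward, so the three
-- parities add up to an even number.  Configurations D and E are B and C for the
-- reversed orientation.

open import Defs
open import Function using (_∘_)
open import Data.Empty using (⊥; ⊥-elim)
open import Data.Fin using (Fin; zero; suc; toℕ; fromℕ)
open import Data.Fin.Properties using (toℕ<n) renaming (_≟_ to _≟ᶠ_)
open import Data.List using (List; []; _∷_; filter; length; tabulate; map; _++_; allFin)
open import Data.List.Properties using (filter-++; length-++; map-tabulate)
open import Data.Nat using (ℕ; zero; suc; _+_; _<_; _≤_; z≤n; s≤s; parity; _≟_)
open import Data.Nat.Divisibility using (_∣_; divides)
open import Data.Nat.Properties
  using (+-comm; +-assoc; m<n⇒m<1+n; <-irrefl; 1+n≢n; 1+n≢0; suc-injective; ≤-refl; <⇒≤)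
open import Data.Parity.Base using (Parity; 0ℙ; 1ℙ; _⁻¹) renaming (_+_ to _⊕_)
open import Data.Parity.Properties using (p+p≡0ℙ; suc-homo-⁻¹; ⁻¹-involutive; +-homo-+)
open import Data.Product using (Σ; _×_; _,_; proj₁; proj₂)
import Data.Product as Product
open import Data.Product.Properties using () renaming (≡-dec to ×-≡-dec)
open import Data.Sum using (_⊎_; inj₁; inj₂; [_,_])
import Data.Sum as Sum
open import Data.Sum.Properties using () renaming (≡-dec to ⊎-≡-dec)
open import Data.Unit using (⊤; tt)
open import Relation.Binary.Definitions using (DecidableEquality)
open import Relation.Nullary using (¬_; Dec; yes; no)
open import Relation.Nullary.Decidable using (map′)
open import Relation.Binary.PropositionalEquality
  using (_≡_; _≢_; refl; sym; trans; cong; cong₂; subst; subst₂; module ≡-Reasoning)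

-- Parity along a path

-- Directions are parities, so that a ⊕ b records whether a and b differ.
directed : Parity → Dir
directed 0ℙ = fwd
directed 1ℙ = bwd

directed-injective : ∀ {p q} → directed p ≡ directed q → p ≡ q
directed-injective {0ℙ} {0ℙ} _ = refl
directed-injective {1ℙ} {1ℙ} _ = refl

conflict : ∀ {d} → d ≡ fwd → d ≡ bwd → ⊥
conflict refl ()

directed≢undir : ∀ p → directed p ≢ undir
directed≢undir 0ℙ ()
directed≢undir 1ℙ ()

undir-or-directed : ∀ d → d ≡ undir ⊎ Σ Parity (λ p → d ≡ directed p)
undir-or-directed undir = inj₁ refl
undir-or-directed fwd   = inj₂ (0ℙ , refl)
undir-or-directed bwd   = inj₂ (1ℙ , refl)

Opposite : Dir → Dir → Set
Opposite fwd bwd = ⊤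
Opposite bwd fwd = ⊤
Opposite _   _   = ⊥

opposite-intro : ∀ {x y} → y ≡ bwd ⊎ x ≡ bwd → x ≡ fwd ⊎ y ≡ fwd → Opposite x y
opposite-intro (inj₁ refl) (inj₁ refl) = tt
opposite-intro (inj₂ refl) (inj₂ refl) = tt
opposite-intro (inj₁ refl) (inj₂ ())
opposite-intro (inj₂ refl) (inj₁ ())

opposite-directed : ∀ {p d} → Opposite (directed p) d → d ≡ directed (p ⁻¹)
opposite-directed {0ℙ} {bwd} _ = refl
opposite-directed {1ℙ} {fwd} _ = refl

same-heading : ∀ {p q} → ¬ Opposite (directed p) (directed q) → p ≡ q
same-heading {0ℙ} {0ℙ} _ = refl
same-heading {1ℙ} {1ℙ} _ = refl
same-heading {0ℙ} {1ℙ} ¬opp = ⊥-elim (¬opp tt)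
same-heading {1ℙ} {0ℙ} ¬opp = ⊥-elim (¬opp tt)

⁻¹-⊕ˡ : ∀ p q → ((p ⁻¹) ⊕ q) ⁻¹ ≡ p ⊕ q
⁻¹-⊕ˡ 0ℙ q = ⁻¹-involutive q
⁻¹-⊕ˡ 1ℙ q = refl

⁻¹-⊕ʳ : ∀ p q → (p ⊕ (q ⁻¹)) ⁻¹ ≡ p ⊕ q
⁻¹-⊕ʳ 0ℙ q = ⁻¹-involutive q
⁻¹-⊕ʳ 1ℙ q = cong _⁻¹ (⁻¹-involutive q)

parity-suc : ∀ n → parity (suc n) ≡ parity n ⁻¹
parity-suc n = sym (suc-homo-⁻¹ (suc n))

parity≡0ℙ⇒even : ∀ n → parity n ≡ 0ℙ → 2 ∣ n
parity≡0ℙ⇒even zero          _  = divides 0 refl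
parity≡0ℙ⇒even (suc zero)    ()
parity≡0ℙ⇒even (suc (suc n)) eq with parity≡0ℙ⇒even n eq
... | divides q n≡q*2 = divides (suc q) (cong (λ m → suc (suc m)) n≡q*2)

weight : Dir → ℕ
weight undir = 1
weight fwd   = 0
weight bwd   = 0

countUndirected : ℕ → (ℕ → Dir) → ℕ
countUndirected zero    f = 0
countUndirected (suc n) f = weight (f 0) + countUndirected n (λ i → f (suc i))

countUndirected-snoc : ∀ n f → countUndirected (suc n) f ≡ countUndirected n f + weight (f n)
countUndirected-snoc zero    f = +-comm (weight (f 0)) 0
countUndirected-snoc (suc n) f = trans
  (cong (weight (f 0) +_) (countUndirected-snoc n (λ i → f (suc i))))
  (sym (+-assoc (weight (f 0)) _ _))

countUndirected-head : ∀ n f {d} → f 0 ≡ d →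
  countUndirected (suc n) f ≡ weight d + countUndirected n (λ i → f (suc i))
countUndirected-head n f = cong (λ d → weight d + countUndirected n (λ i → f (suc i)))

countUndirected-directed : ∀ n f {p} → f 0 ≡ directed p →
  countUndirected (suc n) f ≡ countUndirected n (λ i → f (suc i))
countUndirected-directed n f {0ℙ} = countUndirected-head n f
countUndirected-directed n f {1ℙ} = countUndirected-head n f

-- A path with edges 0, …, m, where f i is the state of edge i and fwd points
-- away from the start of the path.
record WellOriented (m : ℕ) (f : ℕ → Dir) : Set where
  field
    no-reversal     : ∀ {i} → i < m → ¬ Opposite (f i) (f (suc i))
    reversal-at-gap : ∀ {i} → suc i < m → f (suc i) ≡ undir → Opposite (f i) (f (suc (suc i)))

open WellOriented

wellOriented-tail : ∀ {m f} → WellOriented (suc m) f → WellOriented m (λ i → f (suc i))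
wellOriented-tail w = record
  { no-reversal     = λ i<m → no-reversal w (s≤s i<m)
  ; reversal-at-gap = λ i<m → reversal-at-gap w (s≤s i<m)
  }

wellOriented-init : ∀ {m f} → WellOriented (suc m) f → WellOriented m f
wellOriented-init w = record
  { no-reversal     = λ i<m → no-reversal w (m<n⇒m<1+n i<m)
  ; reversal-at-gap = λ i<m → reversal-at-gap w (m<n⇒m<1+n i<m)
  }

-- An undirected end edge is read as pointing against its neighbour.
data StartsAs (f : ℕ → Dir) (a : Parity) : Set where
  directedStart : f 0 ≡ directed a → StartsAs f a
  flippedStart  : f 0 ≡ undir → f 1 ≡ directed (a ⁻¹) → StartsAs f a

data EndsAs : ℕ → (ℕ → Dir) → Parity → Set where
  directedEnd : ∀ {m f b} → f m ≡ directed b → EndsAs m f b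
  flippedEnd  : ∀ {m f b} → f (suc m) ≡ undir → f m ≡ directed (b ⁻¹) → EndsAs (suc m) f b

parity-directed : ∀ m {f a b} → WellOriented m f → f 0 ≡ directed a → f m ≡ directed b →
  parity (countUndirected (suc m) f) ≡ a ⊕ b
parity-directed zero {f} {a} {b} w f0 fm = begin
  parity (countUndirected 1 f) ≡⟨ cong parity (countUndirected-directed 0 f f0) ⟩
  0ℙ                           ≡⟨ sym (p+p≡0ℙ a) ⟩
  a ⊕ a                        ≡⟨ cong (a ⊕_) (directed-injective (trans (sym f0) fm)) ⟩
  a ⊕ b                        ∎
  where open ≡-Reasoning
parity-directed (suc m) {f} {a} {b} w f0 fm with undir-or-directed (f 1)
... | inj₂ (p , f1) = begin
  parity (countUndirected (suc (suc m)) f)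
    ≡⟨ cong parity (countUndirected-directed (suc m) f f0) ⟩
  parity (countUndirected (suc m) (λ i → f (suc i)))
    ≡⟨ parity-directed m (wellOriented-tail w) f1 fm ⟩
  p ⊕ b
    ≡⟨ cong (_⊕ b) (sym (same-heading aligned)) ⟩
  a ⊕ b ∎
  where
    open ≡-Reasoning
    aligned : ¬ Opposite (directed a) (directed p)
    aligned opp = no-reversal w (s≤s z≤n) (subst₂ Opposite (sym f0) (sym f1) opp)
parity-directed (suc zero) w f0 fm | inj₁ f1 = ⊥-elim (directed≢undir _ (trans (sym fm) f1))
parity-directed (suc (suc m)) {f} {a} {b} w f0 fm | inj₁ f1 = begin
  parity (countUndirected (suc (suc (suc m))) f)
    ≡⟨ cong parity (countUndirected-directed (suc (suc m)) f f0) ⟩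
  parity (countUndirected (suc (suc m)) (λ i → f (suc i)))
    ≡⟨ cong parity (countUndirected-head (suc m) (λ i → f (suc i)) f1) ⟩
  parity (suc (countUndirected (suc m) (λ i → f (suc (suc i)))))
    ≡⟨ parity-suc (countUndirected (suc m) (λ i → f (suc (suc i)))) ⟩
  parity (countUndirected (suc m) (λ i → f (suc (suc i)))) ⁻¹
    ≡⟨ cong _⁻¹ (parity-directed m (wellOriented-tail (wellOriented-tail w)) f2 fm) ⟩
  ((a ⁻¹) ⊕ b) ⁻¹
    ≡⟨ ⁻¹-⊕ˡ a b ⟩
  a ⊕ b ∎
  where
    open ≡-Reasoning
    f2 : f 2 ≡ directed (a ⁻¹)
    f2 = opposite-directed (subst₂ Opposite f0 refl (reversal-at-gap w (s≤s (s≤s z≤n)) f1))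

endsAs-tail : ∀ {m f b} → f 1 ≢ undir → EndsAs (suc m) f b → EndsAs m (λ i → f (suc i)) b
endsAs-tail _  (directedEnd fm)                     = directedEnd fm
endsAs-tail f1 (flippedEnd {m = zero} f1u _)        = ⊥-elim (f1 f1u)
endsAs-tail _  (flippedEnd {m = suc m} fsm fm)      = flippedEnd fsm fm

parity-of-path : ∀ m {f a b} → WellOriented m f → StartsAs f a → EndsAs m f b →
  parity (countUndirected (suc m) f) ≡ a ⊕ b
parity-of-path m w (directedStart f0) (directedEnd fm) = parity-directed m w f0 fm
parity-of-path (suc m) {f} {a} {b} w (directedStart f0) (flippedEnd fsm fm) = begin
  parity (countUndirected (suc (suc m)) f)
    ≡⟨ cong parity (countUndirected-snoc (suc m) f) ⟩
  parity (countUndirected (suc m) f + weight (f (suc m)))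
    ≡⟨ cong (λ d → parity (countUndirected (suc m) f + weight d)) fsm ⟩
  parity (countUndirected (suc m) f + 1)
    ≡⟨ cong parity (+-comm (countUndirected (suc m) f) 1) ⟩
  parity (suc (countUndirected (suc m) f))
    ≡⟨ parity-suc (countUndirected (suc m) f) ⟩
  parity (countUndirected (suc m) f) ⁻¹
    ≡⟨ cong _⁻¹ (parity-directed m (wellOriented-init w) f0 fm) ⟩
  (a ⊕ (b ⁻¹)) ⁻¹
    ≡⟨ ⁻¹-⊕ʳ a b ⟩
  a ⊕ b ∎
  where open ≡-Reasoning
parity-of-path zero w (flippedStart f0 _) (directedEnd f0') =
  ⊥-elim (directed≢undir _ (trans (sym f0') f0))
parity-of-path (suc m) {f} {a} {b} w (flippedStart f0 f1) end = begin
  parity (countUndirected (suc (suc m)) f)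
    ≡⟨ cong parity (countUndirected-head (suc m) f f0) ⟩
  parity (suc (countUndirected (suc m) (λ i → f (suc i))))
    ≡⟨ parity-suc (countUndirected (suc m) (λ i → f (suc i))) ⟩
  parity (countUndirected (suc m) (λ i → f (suc i))) ⁻¹
    ≡⟨ cong _⁻¹ (parity-of-path m (wellOriented-tail w) (directedStart f1)
                   (endsAs-tail (λ f1u → directed≢undir _ (trans (sym f1) f1u)) end)) ⟩
  ((a ⁻¹) ⊕ b) ⁻¹
    ≡⟨ ⁻¹-⊕ˡ a b ⟩
  a ⊕ b ∎
  where open ≡-Reasoning

clamp : ∀ n → ℕ → Fin (suc n)
clamp n       zero    = zero
clamp zero    (suc i) = zero
clamp (suc n) (suc i) = suc (clamp n i)

toℕ-clamp : ∀ {n i} → i ≤ n → toℕ (clamp n i) ≡ i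
toℕ-clamp {n}     {zero}  _         = refl
toℕ-clamp {suc n} {suc i} (s≤s i≤n) = cong suc (toℕ-clamp i≤n)

clamp-toℕ : ∀ {n} (x : Fin (suc n)) → clamp n (toℕ x) ≡ x
clamp-toℕ zero              = refl
clamp-toℕ {suc n} (suc x)   = cong suc (clamp-toℕ x)

clamp-last : ∀ n → clamp n n ≡ fromℕ n
clamp-last zero    = refl
clamp-last (suc n) = cong suc (clamp-last n)

toℕ⇒clamp : ∀ {n i} {x : Fin (suc n)} → toℕ x ≡ i → x ≡ clamp n i
toℕ⇒clamp {n} {x = x} eq = trans (sym (clamp-toℕ x)) (cong (clamp n) eq)

countUndirected-tabulate : ∀ {A : Set} (d : A → Dir) n (g : Fin (suc n) → A) →
  length (filter (λ a → isUndir (d a)) (tabulate g))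
    ≡ countUndirected (suc n) (λ i → d (g (clamp n i)))
countUndirected-tabulate d zero g with d (g zero)
... | undir = refl
... | fwd   = refl
... | bwd   = refl
countUndirected-tabulate d (suc n) g with d (g zero) | countUndirected-tabulate d n (g ∘ suc)
... | undir | ih = cong suc ih
... | fwd   | ih = ih
... | bwd   | ih = ih

≡-dec-via-retraction : ∀ {A B : Set} (to : A → B) (from : B → A) → (∀ x → from (to x) ≡ x) →
  DecidableEquality B → DecidableEquality A
≡-dec-via-retraction to from from∘to _≟B_ x y = map′ injective (cong to) (to x ≟B to y)
  where
    injective : to x ≡ to y → x ≡ y
    injective eq = trans (sym (from∘to x)) (trans (cong from eq) (from∘to y))

-- The j-2-k graph

-- Left inverses of upPos n and lowPos n; the values off the path are junk.
upIndex : ℕ → Vtx → ℕ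
upIndex n L        = 0
upIndex n R        = n
upIndex n mid      = 0
upIndex n (upV p)  = p
upIndex n (lowV _) = 0

lowIndex : ℕ → Vtx → ℕ
lowIndex n L        = 0
lowIndex n R        = n
lowIndex n mid      = 0
lowIndex n (upV _)  = 0
lowIndex n (lowV p) = p

upIndex-upPos : ∀ n p → upIndex n (upPos n p) ≡ p
upIndex-upPos n zero    = refl
upIndex-upPos n (suc p) with suc p ≟ n
... | yes eq = sym eq
... | no _   = refl

lowIndex-lowPos : ∀ n p → lowIndex n (lowPos n p) ≡ p
lowIndex-lowPos n zero    = refl
lowIndex-lowPos n (suc p) with suc p ≟ n
... | yes eq = sym eq
... | no _   = refl

upPos-index : ∀ {n p v} → upPos n p ≡ v → p ≡ upIndex n v
upPos-index {n} {p} eq = trans (sym (upIndex-upPos n p)) (cong (upIndex n) eq)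

lowPos-index : ∀ {n p v} → lowPos n p ≡ v → p ≡ lowIndex n v
lowPos-index {n} {p} eq = trans (sym (lowIndex-lowPos n p)) (cong (lowIndex n) eq)

OnUpper OnLower : Vtx → Set
OnUpper L        = ⊤
OnUpper R        = ⊤
OnUpper mid      = ⊥
OnUpper (upV _)  = ⊤
OnUpper (lowV _) = ⊥
OnLower L        = ⊤
OnLower R        = ⊤
OnLower mid      = ⊥
OnLower (upV _)  = ⊥
OnLower (lowV _) = ⊤

upPos-onUpper : ∀ n p → OnUpper (upPos n p)
upPos-onUpper n zero    = tt
upPos-onUpper n (suc p) with suc p ≟ n
... | yes _ = tt
... | no _  = tt

lowPos-onLower : ∀ n p → OnLower (lowPos n p)
lowPos-onLower n zero    = tt
lowPos-onLower n (suc p) with suc p ≟ n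
... | yes _ = tt
... | no _  = tt

upPos-inner : ∀ {n i} → suc i < n → upPos n (suc i) ≡ upV (suc i)
upPos-inner {n} {i} i<n with suc i ≟ n
... | yes refl = ⊥-elim (<-irrefl refl i<n)
... | no _     = refl

lowPos-inner : ∀ {n i} → suc i < n → lowPos n (suc i) ≡ lowV (suc i)
lowPos-inner {n} {i} i<n with suc i ≟ n
... | yes refl = ⊥-elim (<-irrefl refl i<n)
... | no _     = refl

upPos-last : ∀ n → upPos (suc n) (suc n) ≡ R
upPos-last n with suc n ≟ suc n
... | yes _  = refl
... | no neq = ⊥-elim (neq refl)

lowPos-last : ∀ n → lowPos (suc n) (suc n) ≡ R
lowPos-last n with suc n ≟ suc n
... | yes _  = refl
... | no neq = ⊥-elim (neq refl)

vtxCode : Vtx → ℕ × ℕ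
vtxCode L        = 0 , 0
vtxCode R        = 1 , 0
vtxCode mid      = 2 , 0
vtxCode (upV p)  = 3 , p
vtxCode (lowV p) = 4 , p

vtxDecode : ℕ × ℕ → Vtx
vtxDecode (0 , _) = L
vtxDecode (1 , _) = R
vtxDecode (2 , _) = mid
vtxDecode (3 , p) = upV p
vtxDecode (_ , p) = lowV p

vtxDecode-vtxCode : ∀ v → vtxDecode (vtxCode v) ≡ v
vtxDecode-vtxCode L        = refl
vtxDecode-vtxCode R        = refl
vtxDecode-vtxCode mid      = refl
vtxDecode-vtxCode (upV p)  = refl
vtxDecode-vtxCode (lowV p) = refl

_≟V_ : DecidableEquality Vtx
_≟V_ = ≡-dec-via-retraction vtxCode vtxDecode vtxDecode-vtxCode (×-≡-dec _≟_ _≟_)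

module _ {j k : ℕ} where

  edgeCode : Edge j k → Fin j ⊎ Fin 2 ⊎ Fin k
  edgeCode (upE x)  = inj₁ x
  edgeCode (midE x) = inj₂ (inj₁ x)
  edgeCode (lowE x) = inj₂ (inj₂ x)

  edgeDecode : Fin j ⊎ Fin 2 ⊎ Fin k → Edge j k
  edgeDecode (inj₁ x)        = upE x
  edgeDecode (inj₂ (inj₁ x)) = midE x
  edgeDecode (inj₂ (inj₂ x)) = lowE x

  edgeDecode-edgeCode : ∀ e → edgeDecode (edgeCode e) ≡ e
  edgeDecode-edgeCode (upE x)  = refl
  edgeDecode-edgeCode (midE x) = refl
  edgeDecode-edgeCode (lowE x) = refl

  _≟E_ : DecidableEquality (Edge j k)
  _≟E_ = ≡-dec-via-retraction edgeCode edgeDecode edgeDecode-edgeCode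
           (⊎-≡-dec _≟ᶠ_ (⊎-≡-dec _≟ᶠ_ _≟ᶠ_))

  tail≢head : (e : Edge j k) → tailV e ≢ headV e
  tail≢head (upE x)           eq = 1+n≢n (sym (trans (upPos-index eq) (upIndex-upPos j _)))
  tail≢head (lowE x)          eq = 1+n≢n (sym (trans (lowPos-index eq) (lowIndex-lowPos k _)))
  tail≢head (midE zero)       ()
  tail≢head (midE (suc zero)) ()

  head≢L : (e : Edge j k) → headV e ≢ L
  head≢L (upE x)           eq = 1+n≢0 (upPos-index eq)
  head≢L (lowE x)          eq = 1+n≢0 (lowPos-index eq)
  head≢L (midE zero)       ()
  head≢L (midE (suc zero)) ()

  tail≢R : (e : Edge j k) → tailV e ≢ R
  tail≢R (upE x)           eq = <-irrefl (upPos-index eq) (toℕ<n x)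
  tail≢R (lowE x)          eq = <-irrefl (lowPos-index eq) (toℕ<n x)
  tail≢R (midE zero)       ()
  tail≢R (midE (suc zero)) ()

  ≢-of-tail≡head : ∀ {c e : Edge j k} → tailV c ≡ headV e → c ≢ e
  ≢-of-tail≡head {c} t refl = tail≢head c t

  ≢-of-head≡tail : ∀ {c e : Edge j k} → headV c ≡ tailV e → c ≢ e
  ≢-of-head≡tail {c} h refl = tail≢head c (sym h)

-- Sinks, sources and maximality

reverse : Dir → Dir
reverse undir = undir
reverse fwd   = bwd
reverse bwd   = fwd

reverse-involutive : ∀ d → reverse (reverse d) ≡ d
reverse-involutive undir = refl
reverse-involutive fwd   = refl
reverse-involutive bwd   = refl

reverse-undir : ∀ {d} → reverse d ≡ undir → d ≡ undir
reverse-undir {undir} _ = refl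

reverse-fwd : ∀ {d} → reverse d ≡ fwd → d ≡ bwd
reverse-fwd {bwd} _ = refl

reverse-bwd : ∀ {d} → reverse d ≡ bwd → d ≡ fwd
reverse-bwd {fwd} _ = refl

module _ {j k : ℕ} (o : Orientation j k) (c : Edge j k) {v : Vtx} where

  into-at-head : Into o c v → headV c ≡ v → o c ≡ fwd
  into-at-head (inj₁ (f , _)) _ = f
  into-at-head (inj₂ (_ , t)) h = ⊥-elim (tail≢head c (trans t (sym h)))

  into-at-tail : Into o c v → tailV c ≡ v → o c ≡ bwd
  into-at-tail (inj₁ (_ , h)) t = ⊥-elim (tail≢head c (trans t (sym h)))
  into-at-tail (inj₂ (b , _)) _ = b

  outOf-at-head : OutOf o c v → headV c ≡ v → o c ≡ bwd
  outOf-at-head (inj₁ (_ , t)) h = ⊥-elim (tail≢head c (trans t (sym h)))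
  outOf-at-head (inj₂ (b , _)) _ = b

  outOf-at-tail : OutOf o c v → tailV c ≡ v → o c ≡ fwd
  outOf-at-tail (inj₁ (f , _)) _ = f
  outOf-at-tail (inj₂ (_ , h)) t = ⊥-elim (tail≢head c (trans t (sym h)))

  into-reverse : Into (reverse ∘ o) c v → OutOf o c v
  into-reverse (inj₁ (f , h)) = inj₂ (reverse-fwd f , h)
  into-reverse (inj₂ (b , t)) = inj₁ (reverse-bwd b , t)

  outOf-reverse : OutOf (reverse ∘ o) c v → Into o c v
  outOf-reverse (inj₁ (f , t)) = inj₂ (reverse-fwd f , t)
  outOf-reverse (inj₂ (b , h)) = inj₁ (reverse-bwd b , h)

  into⇒outOf-reverse : Into o c v → OutOf (reverse ∘ o) c v
  into⇒outOf-reverse (inj₁ (f , h)) = inj₂ (cong reverse f , h)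
  into⇒outOf-reverse (inj₂ (b , t)) = inj₁ (cong reverse b , t)

  outOf⇒into-reverse : OutOf o c v → Into (reverse ∘ o) c v
  outOf⇒into-reverse (inj₁ (f , t)) = inj₂ (cong reverse f , t)
  outOf⇒into-reverse (inj₂ (b , h)) = inj₁ (cong reverse b , h)

module _ {j k : ℕ} {o : Orientation j k} {v : Vtx} where

  sink-intro : (∀ c → headV c ≡ v → o c ≡ fwd) → (∀ c → tailV c ≡ v → o c ≡ bwd) →
    Sink o v
  sink-intro into _ c (inj₁ h) = inj₁ (into c h , h)
  sink-intro _ outOf c (inj₂ t) = inj₂ (outOf c t , t)

  source-intro : (∀ c → headV c ≡ v → o c ≡ bwd) → (∀ c → tailV c ≡ v → o c ≡ fwd) →
    Source o v
  source-intro into _ c (inj₁ h) = inj₂ (into c h , h)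
  source-intro _ outOf c (inj₂ t) = inj₁ (outOf c t , t)

SinkExcept SourceExcept : {j k : ℕ} → Orientation j k → Edge j k → Vtx → Set
SinkExcept {j} {k} o e v =
  (c : Edge j k) → c ≢ e → (headV c ≡ v → o c ≡ fwd) × (tailV c ≡ v → o c ≡ bwd)
SourceExcept {j} {k} o e v =
  (c : Edge j k) → c ≢ e → (headV c ≡ v → o c ≡ bwd) × (tailV c ≡ v → o c ≡ fwd)

module _ {j k : ℕ} {o : Orientation j k} {e : Edge j k} {v : Vtx} where

  sinkExcept-reverse : SinkExcept (reverse ∘ o) e v → SourceExcept o e v
  sinkExcept-reverse s c c≢e = Product.map (reverse-fwd ∘_) (reverse-bwd ∘_) (s c c≢e)

  sourceExcept-reverse : SourceExcept (reverse ∘ o) e v → SinkExcept o e v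
  sourceExcept-reverse s c c≢e = Product.map (reverse-bwd ∘_) (reverse-fwd ∘_) (s c c≢e)

module _ {j k : ℕ} where

  update : Orientation j k → Edge j k → Dir → Orientation j k
  update o e d c with c ≟E e
  ... | yes _ = d
  ... | no _  = o c

  update-updatedAt : ∀ o e d → UpdatedAt o e d (update o e d)
  update-updatedAt o e d = at-e , away-from-e
    where
      at-e : update o e d e ≡ d
      at-e with e ≟E e
      ... | yes _  = refl
      ... | no neq = ⊥-elim (neq refl)
      away-from-e : ∀ c → c ≢ e → update o e d c ≡ o c
      away-from-e c c≢e with c ≟E e
      ... | yes c≡e = ⊥-elim (c≢e c≡e)
      ... | no _    = refl

SinkOrSourceAtEndOf : {j k : ℕ} → Orientation j k → Edge j k → Set
SinkOrSourceAtEndOf o e = Σ Vtx λ v → (headV e ≡ v ⊎ tailV e ≡ v) × (Sink o v ⊎ Source o v)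

module _ {j k : ℕ} {o o' : Orientation j k} {e : Edge j k} {d : Dir}
         (upd : UpdatedAt o e d o') where

  private
    agrees : ∀ {v} c → headV e ≢ v → tailV e ≢ v → Incident c v → o' c ≡ o c
    agrees c he te inc with c ≟E e
    ... | yes refl = ⊥-elim ([ he , te ] inc)
    ... | no c≢e   = proj₂ upd c c≢e

    into-transport : ∀ {c v} → o' c ≡ o c → Into o' c v → Into o c v
    into-transport eq (inj₁ (f , h)) = inj₁ (trans (sym eq) f , h)
    into-transport eq (inj₂ (b , t)) = inj₂ (trans (sym eq) b , t)

    outOf-transport : ∀ {c v} → o' c ≡ o c → OutOf o' c v → OutOf o c v
    outOf-transport eq (inj₁ (f , t)) = inj₁ (trans (sym eq) f , t)
    outOf-transport eq (inj₂ (b , h)) = inj₂ (trans (sym eq) b , h)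

  at-endpoint : NoSinkNoSource o → HasSinkOrSource o' → SinkOrSourceAtEndOf o' e
  at-endpoint ns (v , isv , s) with headV e ≟V v | tailV e ≟V v
  ... | yes h | _     = v , inj₁ h , s
  ... | no _  | yes t = v , inj₂ t , s
  ... | no he | no te = ⊥-elim (ns (v , isv , Sum.map sink-in-o source-in-o s))
    where
      sink-in-o : Sink o' v → Sink o v
      sink-in-o s c inc = into-transport (agrees c he te inc) (s c inc)
      source-in-o : Source o' v → Source o v
      source-in-o s c inc = outOf-transport (agrees c he te inc) (s c inc)

  sinkExcept : ∀ {v} → Sink o' v → SinkExcept o e v
  sinkExcept s c c≢e = (λ h → trans (sym (proj₂ upd c c≢e)) (into-at-head o' c (s c (inj₁ h)) h))
                     , (λ t → trans (sym (proj₂ upd c c≢e)) (into-at-tail o' c (s c (inj₂ t)) t))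

  sourceExcept : ∀ {v} → Source o' v → SourceExcept o e v
  sourceExcept s c c≢e = (λ h → trans (sym (proj₂ upd c c≢e)) (outOf-at-head o' c (s c (inj₁ h)) h))
                       , (λ t → trans (sym (proj₂ upd c c≢e)) (outOf-at-tail o' c (s c (inj₂ t)) t))

module _ {j k : ℕ} where

  hasSinkOrSource-reverse : {o : Orientation j k} → HasSinkOrSource (reverse ∘ o) → HasSinkOrSource o
  hasSinkOrSource-reverse {o} (v , isv , inj₁ s) = v , isv , inj₂ (λ c inc → into-reverse o c (s c inc))
  hasSinkOrSource-reverse {o} (v , isv , inj₂ s) = v , isv , inj₁ (λ c inc → outOf-reverse o c (s c inc))

  noSinkNoSource-reverse : {o : Orientation j k} → NoSinkNoSource o → NoSinkNoSource (reverse ∘ o)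
  noSinkNoSource-reverse ns = ns ∘ hasSinkOrSource-reverse

  updatedAt-reverse : ∀ {o o' : Orientation j k} {e d} →
    UpdatedAt (reverse ∘ o) e d o' → UpdatedAt o e (reverse d) (reverse ∘ o')
  updatedAt-reverse {o} (at-e , away) =
    cong reverse at-e , λ c c≢e → trans (cong reverse (away c c≢e)) (reverse-involutive (o c))

  maximal-reverse : {o : Orientation j k} → Maximal o → Maximal (reverse ∘ o)
  maximal-reverse mx e eu =
      (λ o' upd → hasSinkOrSource-reverse
                    (proj₂ (mx e (reverse-undir eu)) (reverse ∘ o') (updatedAt-reverse upd)))
    , (λ o' upd → hasSinkOrSource-reverse
                    (proj₁ (mx e (reverse-undir eu)) (reverse ∘ o') (updatedAt-reverse upd)))

  numUndirected-reverse : (o : Orientation j k) → numUndirected (reverse ∘ o) ≡ numUndirected o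
  numUndirected-reverse o = go (allEdges j k)
    where
      go : ∀ xs →
        length (filter (λ e → isUndir (reverse (o e))) xs) ≡ length (filter (λ e → isUndir (o e)) xs)
      go []       = refl
      go (x ∷ xs) with o x
      ... | undir = cong suc (go xs)
      ... | fwd   = go xs
      ... | bwd   = go xs

module _ {j k : ℕ} {o : Orientation j k} (ns : NoSinkNoSource o) (mx : Maximal o) where

  -- Directing e forward creates a sink or a source, necessarily at an end of e;
  -- the end e points into can only become a sink, the other one a source.
  forward-blocked : ∀ {e} → o e ≡ undir → SinkExcept o e (headV e) ⊎ SourceExcept o e (tailV e)
  forward-blocked {e} eu = classify (at-endpoint upd ns (proj₁ (mx e eu) (update o e fwd) upd))
    where
      upd : UpdatedAt o e fwd (update o e fwd)
      upd = update-updatedAt o e fwd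
      classify : SinkOrSourceAtEndOf (update o e fwd) e →
        SinkExcept o e (headV e) ⊎ SourceExcept o e (tailV e)
      classify (_ , inj₁ refl , inj₁ s) = inj₁ (sinkExcept upd s)
      classify (_ , inj₂ refl , inj₂ s) = inj₂ (sourceExcept upd s)
      classify (_ , inj₁ refl , inj₂ s) =
        ⊥-elim (conflict (proj₁ upd) (outOf-at-head (update o e fwd) e (s e (inj₁ refl)) refl))
      classify (_ , inj₂ refl , inj₁ s) =
        ⊥-elim (conflict (proj₁ upd) (into-at-tail (update o e fwd) e (s e (inj₂ refl)) refl))

module _ {j k : ℕ} {o : Orientation j k} (ns : NoSinkNoSource o) (mx : Maximal o) where

  backward-blocked : ∀ {e} → o e ≡ undir → SinkExcept o e (tailV e) ⊎ SourceExcept o e (headV e)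
  backward-blocked eu =
    Sum.swap (Sum.map sinkExcept-reverse sourceExcept-reverse
      (forward-blocked (noSinkNoSource-reverse ns) (maximal-reverse mx) (cong reverse eu)))

  degree-two : ∀ {v a b} → IsVertex j k v →
    (∀ c → headV c ≡ v → c ≡ a) → (∀ c → tailV c ≡ v → c ≡ b) → ¬ Opposite (o a) (o b)
  degree-two {v} {a} {b} isv into outOf opp with o a in oa | o b in ob
  ... | fwd | bwd = ns (v , isv , inj₁ (sink-intro (λ c h → trans (cong o (into c h)) oa)
                                                   (λ c t → trans (cong o (outOf c t)) ob)))
  ... | bwd | fwd = ns (v , isv , inj₂ (source-intro (λ c h → trans (cong o (into c h)) oa)
                                                     (λ c t → trans (cong o (outOf c t)) ob)))

  gap-neighbours : ∀ {a e c} → o e ≡ undir → headV a ≡ tailV e → tailV c ≡ headV e →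
    Opposite (o a) (o c)
  gap-neighbours {a} {e} {c} eu ha tc = opposite-intro forward backward
    where
      forward : o c ≡ bwd ⊎ o a ≡ bwd
      forward = Sum.map (λ s → proj₂ (s c (≢-of-tail≡head tc)) tc)
                        (λ s → proj₁ (s a (≢-of-head≡tail ha)) ha) (forward-blocked ns mx eu)
      backward : o a ≡ fwd ⊎ o c ≡ fwd
      backward = Sum.map (λ s → proj₁ (s a (≢-of-head≡tail ha)) ha)
                         (λ s → proj₂ (s c (≢-of-tail≡head tc)) tc) (backward-blocked eu)

-- The three paths from L to R

-- A path from L to R along the edges edge 0, …, edge n, whose interior
-- vertices inner 1, …, inner n have degree two.
record Route {j k : ℕ} (n : ℕ) : Set where
  field
    edge           : Fin (suc n) → Edge j k
    inner          : ℕ → Vtx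
    first-tail     : tailV (edge zero) ≡ L
    last-head      : headV (edge (clamp n n)) ≡ R
    inner-isVertex : ∀ {i} → i < n → IsVertex j k (inner (suc i))
    head-at        : ∀ {i} → i < n → headV (edge (clamp n i)) ≡ inner (suc i)
    tail-at        : ∀ {i} → i < n → tailV (edge (clamp n (suc i))) ≡ inner (suc i)
    into-inner     : ∀ {i} c → i < n → headV c ≡ inner (suc i) → c ≡ edge (clamp n i)
    outOf-inner    : ∀ {i} c → i < n → tailV c ≡ inner (suc i) → c ≡ edge (clamp n (suc i))

open Route

upper : ∀ {j' k'} → Route {suc j'} {suc k'} j'
upper {j'} {k'} = record
  { edge           = upE
  ; inner          = upV
  ; first-tail     = refl
  ; last-head      = trans (cong (upPos (suc j') ∘ suc) (toℕ-clamp ≤-refl)) (upPos-last j')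
  ; inner-isVertex = λ i<n → s≤s z≤n , s≤s i<n
  ; head-at        = λ i<n → trans (cong (upPos (suc j') ∘ suc) (toℕ-clamp (<⇒≤ i<n)))
                                   (upPos-inner (s≤s i<n))
  ; tail-at        = λ i<n → trans (cong (upPos (suc j')) (toℕ-clamp i<n)) (upPos-inner (s≤s i<n))
  ; into-inner     = λ c _ → into-upV c
  ; outOf-inner    = λ c _ → outOf-upV c
  }
  where
    into-upV : ∀ {i} c → headV c ≡ upV (suc i) → c ≡ upE (clamp j' i)
    into-upV (upE x)           h = cong upE (toℕ⇒clamp (suc-injective (upPos-index h)))
    into-upV (lowE x)          h = ⊥-elim (subst OnLower h (lowPos-onLower (suc k') (suc (toℕ x))))
    into-upV (midE zero)       ()
    into-upV (midE (suc zero)) ()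
    outOf-upV : ∀ {i} c → tailV c ≡ upV (suc i) → c ≡ upE (clamp j' (suc i))
    outOf-upV (upE x)           t = cong upE (toℕ⇒clamp (upPos-index t))
    outOf-upV (lowE x)          t = ⊥-elim (subst OnLower t (lowPos-onLower (suc k') (toℕ x)))
    outOf-upV (midE zero)       ()
    outOf-upV (midE (suc zero)) ()

lower : ∀ {j' k'} → Route {suc j'} {suc k'} k'
lower {j'} {k'} = record
  { edge           = lowE
  ; inner          = lowV
  ; first-tail     = refl
  ; last-head      = trans (cong (lowPos (suc k') ∘ suc) (toℕ-clamp ≤-refl)) (lowPos-last k')
  ; inner-isVertex = λ i<n → s≤s z≤n , s≤s i<n
  ; head-at        = λ i<n → trans (cong (lowPos (suc k') ∘ suc) (toℕ-clamp (<⇒≤ i<n)))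
                                   (lowPos-inner (s≤s i<n))
  ; tail-at        = λ i<n → trans (cong (lowPos (suc k')) (toℕ-clamp i<n)) (lowPos-inner (s≤s i<n))
  ; into-inner     = λ c _ → into-lowV c
  ; outOf-inner    = λ c _ → outOf-lowV c
  }
  where
    into-lowV : ∀ {i} c → headV c ≡ lowV (suc i) → c ≡ lowE (clamp k' i)
    into-lowV (lowE x)          h = cong lowE (toℕ⇒clamp (suc-injective (lowPos-index h)))
    into-lowV (upE x)           h = ⊥-elim (subst OnUpper h (upPos-onUpper (suc j') (suc (toℕ x))))
    into-lowV (midE zero)       ()
    into-lowV (midE (suc zero)) ()
    outOf-lowV : ∀ {i} c → tailV c ≡ lowV (suc i) → c ≡ lowE (clamp k' (suc i))
    outOf-lowV (lowE x)          t = cong lowE (toℕ⇒clamp (lowPos-index t))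
    outOf-lowV (upE x)           t = ⊥-elim (subst OnUpper t (upPos-onUpper (suc j') (toℕ x)))
    outOf-lowV (midE zero)       ()
    outOf-lowV (midE (suc zero)) ()

middle : ∀ {j k} → Route {j} {k} 1
middle {j} {k} = record
  { edge           = midE
  ; inner          = λ _ → mid
  ; first-tail     = refl
  ; last-head      = refl
  ; inner-isVertex = λ _ → tt
  ; head-at        = λ { (s≤s z≤n) → refl }
  ; tail-at        = λ { (s≤s z≤n) → refl }
  ; into-inner     = λ { c (s≤s z≤n) → into-mid c }
  ; outOf-inner    = λ { c (s≤s z≤n) → outOf-mid c }
  }
  where
    into-mid : (c : Edge j k) → headV c ≡ mid → c ≡ midE zero
    into-mid (upE x)           h = ⊥-elim (subst OnUpper h (upPos-onUpper j (suc (toℕ x))))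
    into-mid (lowE x)          h = ⊥-elim (subst OnLower h (lowPos-onLower k (suc (toℕ x))))
    into-mid (midE zero)       _ = refl
    into-mid (midE (suc zero)) ()
    outOf-mid : (c : Edge j k) → tailV c ≡ mid → c ≡ midE (suc zero)
    outOf-mid (upE x)           t = ⊥-elim (subst OnUpper t (upPos-onUpper j (toℕ x)))
    outOf-mid (lowE x)          t = ⊥-elim (subst OnLower t (lowPos-onLower k (toℕ x)))
    outOf-mid (midE zero)       ()
    outOf-mid (midE (suc zero)) _ = refl

along : ∀ {j k n} → Orientation j k → Route {j} {k} n → ℕ → Dir
along {n = n} o P i = o (edge P (clamp n i))

module _ {j k : ℕ} {o : Orientation j k} (ns : NoSinkNoSource o) (mx : Maximal o) where

  route-wellOriented : ∀ {n} (P : Route n) → WellOriented n (along o P)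
  route-wellOriented P = record
    { no-reversal     = λ i<n → degree-two ns mx (inner-isVertex P i<n)
                                  (λ c → into-inner P c i<n) (λ c → outOf-inner P c i<n)
    ; reversal-at-gap = λ {i} i+1<n eu → gap-neighbours ns mx eu
                          (trans (head-at P (<⇒≤ i+1<n)) (sym (tail-at P (<⇒≤ i+1<n))))
                          (trans (tail-at P i+1<n) (sym (head-at P i+1<n)))
    }

  starts-forward : ∀ {n} (P : Route n) → along o P 0 ≢ bwd →
    ¬ SourceExcept o (edge P zero) L → ¬ SinkExcept o (edge P zero) R → StartsAs (along o P) 0ℙ
  starts-forward {n} P not-into no-source no-sink with along o P 0 in e0
  ... | fwd   = directedStart e0
  ... | bwd   = ⊥-elim (not-into refl)
  ... | undir with forward-blocked ns mx e0
  ...   | inj₂ s = ⊥-elim (no-source (subst (SourceExcept o (edge P zero)) (first-tail P) s))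
  ...   | inj₁ s = flippedStart e0 (second-points-back n P s no-sink)
    where
      second-points-back : ∀ n (P : Route n) → SinkExcept o (edge P zero) (headV (edge P zero)) →
        ¬ SinkExcept o (edge P zero) R → along o P 1 ≡ bwd
      second-points-back zero    P s no-sink =
        ⊥-elim (no-sink (subst (SinkExcept o (edge P zero)) (last-head P) s))
      second-points-back (suc n) P s _       = proj₂ (s _ (≢-of-tail≡head t)) t
        where
          t : tailV (edge P (suc zero)) ≡ headV (edge P zero)
          t = trans (tail-at P (s≤s z≤n)) (sym (head-at P (s≤s z≤n)))

  ends-forward : ∀ {n} (P : Route n) → along o P n ≢ bwd →
    ¬ SinkExcept o (edge P (clamp n n)) R → ¬ SourceExcept o (edge P (clamp n n)) L →
    EndsAs n (along o P) 0ℙ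
  ends-forward {n} P not-outOf no-sink no-source with along o P n in en
  ... | fwd   = directedEnd en
  ... | bwd   = ⊥-elim (not-outOf refl)
  ... | undir with forward-blocked ns mx en
  ...   | inj₁ s = ⊥-elim (no-sink (subst (SinkExcept o (edge P (clamp n n))) (last-head P) s))
  ...   | inj₂ s = end-through-gap n P en s no-source
    where
      end-through-gap : ∀ n (P : Route n) → along o P n ≡ undir →
        SourceExcept o (edge P (clamp n n)) (tailV (edge P (clamp n n))) →
        ¬ SourceExcept o (edge P (clamp n n)) L → EndsAs n (along o P) 0ℙ
      end-through-gap zero    P _  s no-source =
        ⊥-elim (no-source (subst (SourceExcept o (edge P zero)) (first-tail P) s))
      end-through-gap (suc n) P en s _         = flippedEnd en (proj₁ (s _ (≢-of-head≡tail h)) h)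
        where
          h : headV (edge P (clamp (suc n) n)) ≡ tailV (edge P (clamp (suc n) (suc n)))
          h = trans (head-at P ≤-refl) (sym (tail-at P ≤-refl))

-- The configurations

module _ {j' k' : ℕ} where

  private
    G : Set
    G = Edge (suc j') (suc k')

  tail≡L : (c : G) → tailV c ≡ L → c ≡ upE zero ⊎ c ≡ midE zero ⊎ c ≡ lowE zero
  tail≡L (upE zero)        _ = inj₁ refl
  tail≡L (upE (suc x))     t = ⊥-elim (1+n≢0 (upPos-index t))
  tail≡L (midE zero)       _ = inj₂ (inj₁ refl)
  tail≡L (midE (suc zero)) ()
  tail≡L (lowE zero)       _ = inj₂ (inj₂ refl)
  tail≡L (lowE (suc x))    t = ⊥-elim (1+n≢0 (lowPos-index t))

  head≡R : (c : G) → headV c ≡ R →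
    c ≡ upE (clamp j' j') ⊎ c ≡ midE (suc zero) ⊎ c ≡ lowE (clamp k' k')
  head≡R (upE x)           h = inj₁ (cong upE (toℕ⇒clamp (suc-injective (upPos-index h))))
  head≡R (midE zero)       ()
  head≡R (midE (suc zero)) _ = inj₂ (inj₁ refl)
  head≡R (lowE x)          h = inj₂ (inj₂ (cong lowE (toℕ⇒clamp (suc-injective (lowPos-index h)))))

  numUndirected-routes : (o : Orientation (suc j') (suc k')) →
    numUndirected o ≡ countUndirected (suc j') (along o upper)
                      + (countUndirected 2 (along o middle) + countUndirected (suc k') (along o lower))
  numUndirected-routes o = begin
    length (filter P? (ups ++ (mids ++ lows)))
      ≡⟨ cong length (filter-++ P? ups (mids ++ lows)) ⟩
    length (filter P? ups ++ filter P? (mids ++ lows))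
      ≡⟨ length-++ (filter P? ups) ⟩
    length (filter P? ups) + length (filter P? (mids ++ lows))
      ≡⟨ cong (length (filter P? ups) +_)
              (trans (cong length (filter-++ P? mids lows)) (length-++ (filter P? mids))) ⟩
    length (filter P? ups) + (length (filter P? mids) + length (filter P? lows))
      ≡⟨ cong₂ _+_ (count upE) (cong₂ _+_ (count midE) (count lowE)) ⟩
    _ ∎
    where
      open ≡-Reasoning
      P? : (e : G) → Dec (o e ≡ undir)
      P? e = isUndir (o e)
      ups mids lows : List G
      ups  = map upE (allFin (suc j'))
      mids = map midE (allFin 2)
      lows = map lowE (allFin (suc k'))
      count : ∀ {n} (E : Fin (suc n) → G) →
        length (filter P? (map E (allFin (suc n)))) ≡ countUndirected (suc n) (λ i → o (E (clamp n i)))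
      count {n} E = trans (cong (length ∘ filter P?) (map-tabulate (λ x → x) E))
                          (countUndirected-tabulate o n E)

module _ {j' k' : ℕ} (o : Orientation (suc j') (suc k')) (ns : NoSinkNoSource o) (mx : Maximal o) where

  private
    U M W : ℕ → Dir
    U = along o upper
    M = along o middle
    W = along o lower

    no-sink-at-L : ¬ (U 0 ≡ bwd × M 0 ≡ bwd × W 0 ≡ bwd)
    no-sink-at-L (u , m , w) = ns (L , tt , inj₁ (sink-intro (λ c h → ⊥-elim (head≢L c h)) into-L))
      where
        into-L : ∀ c → tailV c ≡ L → o c ≡ bwd
        into-L c t with tail≡L c t
        ... | inj₁ refl        = u
        ... | inj₂ (inj₁ refl) = m
        ... | inj₂ (inj₂ refl) = w

    no-source-at-R : ¬ (U j' ≡ bwd × M 1 ≡ bwd × W k' ≡ bwd)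
    no-source-at-R (u , m , w) =
      ns (R , tt , inj₂ (source-intro outOf-R (λ c t → ⊥-elim (tail≢R c t))))
      where
        outOf-R : ∀ c → headV c ≡ R → o c ≡ bwd
        outOf-R c h with head≡R c h
        ... | inj₁ refl        = u
        ... | inj₂ (inj₁ refl) = m
        ... | inj₂ (inj₂ refl) = w

    upper-last : headV (upE {suc j'} {suc k'} (clamp j' j')) ≡ R
    upper-last = last-head (upper {j'} {k'})

    lower-last : headV (lowE {suc j'} {suc k'} (clamp k' k')) ≡ R
    lower-last = last-head (lower {j'} {k'})

    middle-no-reversal : ∀ {a b} → M 0 ≡ a → M 1 ≡ b → ¬ Opposite a b
    middle-no-reversal refl refl = WellOriented.no-reversal (route-wellOriented ns mx middle) (s≤s z≤n)

    lower-starts-forward : U 0 ≡ bwd → M 0 ≡ bwd → StartsAs W 0ℙ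
    lower-starts-forward u0 m0 = starts-forward ns mx lower
      (λ w0 → no-sink-at-L (u0 , m0 , w0))
      (λ s → conflict (proj₂ (s (upE zero) λ ()) refl) u0)
      (λ s → middle-no-reversal m0 (proj₁ (s (midE (suc zero)) λ ()) refl) tt)

    lower-ends-forward : U j' ≡ bwd → M 1 ≡ bwd → EndsAs k' W 0ℙ
    lower-ends-forward uj m1 = ends-forward ns mx lower
      (λ wk → no-source-at-R (uj , m1 , wk))
      (λ s → conflict (proj₁ (s (upE (clamp j' j')) λ ()) upper-last) uj)
      (λ s → middle-no-reversal (proj₂ (s (midE zero) λ ()) refl) m1 tt)

    upper-ends-forward : W k' ≡ bwd → M 1 ≡ bwd → EndsAs j' U 0ℙ
    upper-ends-forward wk m1 = ends-forward ns mx upper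
      (λ uj → no-source-at-R (uj , m1 , wk))
      (λ s → conflict (proj₁ (s (lowE (clamp k' k')) λ ()) lower-last) wk)
      (λ s → middle-no-reversal (proj₂ (s (midE zero) λ ()) refl) m1 tt)

    middle-starts-forward : U 0 ≡ bwd → W 0 ≡ bwd → U j' ≡ bwd → StartsAs M 0ℙ
    middle-starts-forward u0 w0 uj = starts-forward ns mx middle
      (λ m0 → no-sink-at-L (u0 , m0 , w0))
      (λ s → conflict (proj₂ (s (upE zero) λ ()) refl) u0)
      (λ s → conflict (proj₁ (s (upE (clamp j' j')) λ ()) upper-last) uj)

    middle-ends-forward : U 0 ≡ bwd → U j' ≡ bwd → W k' ≡ bwd → EndsAs 1 M 0ℙ
    middle-ends-forward u0 uj wk = ends-forward ns mx middle
      (λ m1 → no-source-at-R (uj , m1 , wk))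
      (λ s → conflict (proj₁ (s (upE (clamp j' j')) λ ()) upper-last) uj)
      (λ s → conflict (proj₂ (s (upE zero) λ ()) refl) u0)

    middle-end-cases : M 0 ≡ bwd → M 1 ≡ bwd ⊎ (M 1 ≡ undir × U j' ≡ bwd × W k' ≡ bwd)
    middle-end-cases m0 with M 1 in m1
    ... | bwd   = inj₁ refl
    ... | fwd   = ⊥-elim (middle-no-reversal m0 m1 tt)
    ... | undir with backward-blocked ns mx m1
    ...   | inj₁ s = ⊥-elim (conflict (proj₁ (s (midE zero) λ ()) refl) m0)
    ...   | inj₂ s = inj₂ (refl , proj₁ (s (upE (clamp j' j')) λ ()) upper-last
                                , proj₁ (s (lowE (clamp k' k')) λ ()) lower-last)

    even-of-ends : ∀ {a b c d e f} → StartsAs U a → EndsAs j' U b → StartsAs M c → EndsAs 1 M d →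
      StartsAs W e → EndsAs k' W f → (a ⊕ b) ⊕ ((c ⊕ d) ⊕ (e ⊕ f)) ≡ 0ℙ → 2 ∣ numUndirected o
    even-of-ends sU eU sM eM sW eW sum≡0 = parity≡0ℙ⇒even (numUndirected o) (begin
      parity (numUndirected o)   ≡⟨ cong parity (numUndirected-routes o) ⟩
      parity (countUndirected (suc j') U + (countUndirected 2 M + countUndirected (suc k') W))
        ≡⟨ +-homo-+ (countUndirected (suc j') U) _ ⟩
      parity (countUndirected (suc j') U) ⊕ parity (countUndirected 2 M + countUndirected (suc k') W)
        ≡⟨ cong (parity (countUndirected (suc j') U) ⊕_) (+-homo-+ (countUndirected 2 M) _) ⟩
      parity (countUndirected (suc j') U)
        ⊕ (parity (countUndirected 2 M) ⊕ parity (countUndirected (suc k') W))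
        ≡⟨ cong₂ _⊕_ (parity-of-path j' (route-wellOriented ns mx upper) sU eU)
                     (cong₂ _⊕_ (parity-of-path 1 (route-wellOriented ns mx middle) sM eM)
                                (parity-of-path k' (route-wellOriented ns mx lower) sW eW)) ⟩
      _                          ≡⟨ sum≡0 ⟩
      0ℙ                         ∎)
      where open ≡-Reasoning

    outOf-R-upper : OutOf o (upE (fromℕ j')) R → U j' ≡ bwd
    outOf-R-upper out =
      outOf-at-head o _ (subst (λ x → OutOf o (upE x) R) (sym (clamp-last j')) out) upper-last

    outOf-R-lower : OutOf o (lowE (fromℕ k')) R → W k' ≡ bwd
    outOf-R-lower out =
      outOf-at-head o _ (subst (λ x → OutOf o (lowE x) R) (sym (clamp-last k')) out) lower-last

    even-A : U 0 ≡ bwd → W 0 ≡ bwd → U j' ≡ bwd → W k' ≡ bwd → 2 ∣ numUndirected o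
    even-A u0 w0 uj wk = even-of-ends
      (directedStart u0)                 (directedEnd uj)
      (middle-starts-forward u0 w0 uj)   (middle-ends-forward u0 uj wk)
      (directedStart w0)                 (directedEnd wk)
      refl

    even-B : U 0 ≡ bwd → M 0 ≡ bwd → U j' ≡ bwd → 2 ∣ numUndirected o
    even-B u0 m0 uj with middle-end-cases m0
    ... | inj₁ m1 = even-of-ends
      (directedStart u0)                 (directedEnd uj)
      (directedStart m0)                 (directedEnd m1)
      (lower-starts-forward u0 m0)       (lower-ends-forward uj m1)
      refl
    ... | inj₂ (m1 , _ , wk) = even-of-ends
      (directedStart u0)                 (directedEnd uj)
      (directedStart m0)                 (flippedEnd m1 m0)
      (lower-starts-forward u0 m0)       (directedEnd wk)
      refl

    even-C : U 0 ≡ bwd → M 0 ≡ bwd → W k' ≡ bwd → 2 ∣ numUndirected o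
    even-C u0 m0 wk with middle-end-cases m0
    ... | inj₁ m1 = even-of-ends
      (directedStart u0)                 (upper-ends-forward wk m1)
      (directedStart m0)                 (directedEnd m1)
      (lower-starts-forward u0 m0)       (directedEnd wk)
      refl
    ... | inj₂ (m1 , uj , _) = even-of-ends
      (directedStart u0)                 (directedEnd uj)
      (directedStart m0)                 (flippedEnd m1 m0)
      (lower-starts-forward u0 m0)       (directedEnd wk)
      refl

  open Primary j' k'

  configA-even : ConfigA o → 2 ∣ numUndirected o
  configA-even (i1 , i2 , o5 , o6) =
    even-A (into-at-tail o e1 i1 refl) (into-at-tail o e2 i2 refl) (outOf-R-upper o6) (outOf-R-lower o5)

  configB-even : ConfigB o → 2 ∣ numUndirected o
  configB-even (i1 , i3 , o6) =
    even-B (into-at-tail o e1 i1 refl) (into-at-tail o e3 i3 refl) (outOf-R-upper o6)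

  configC-even : ConfigC o → 2 ∣ numUndirected o
  configC-even (i1 , i3 , o5) =
    even-C (into-at-tail o e1 i1 refl) (into-at-tail o e3 i3 refl) (outOf-R-lower o5)

module _ {j' k' : ℕ} (o : Orientation (suc j') (suc k')) where
  open Primary j' k'

  configD-reverse : ConfigD o → ConfigB (reverse ∘ o)
  configD-reverse (o1 , o3 , i6) =
    outOf⇒into-reverse o e1 o1 , outOf⇒into-reverse o e3 o3 , into⇒outOf-reverse o e6 i6

  configE-reverse : ConfigE o → ConfigC (reverse ∘ o)
  configE-reverse (o1 , o3 , i5) =
    outOf⇒into-reverse o e1 o1 , outOf⇒into-reverse o e3 o3 , into⇒outOf-reverse o e5 i5

lemma3 : (j' k' : ℕ) → ¬ ((j' ≡ zero) × (k' ≡ zero)) →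
    (o : Orientation (suc j') (suc k')) →
    NoSinkNoSource o → Maximal o → Primary.SomeConfig j' k' o →
    2 ∣ numUndirected o
lemma3 j' k' _ o ns mx (inj₁ a)                          = configA-even o ns mx a
lemma3 j' k' _ o ns mx (inj₂ (inj₁ b))                   = configB-even o ns mx b
lemma3 j' k' _ o ns mx (inj₂ (inj₂ (inj₁ c)))            = configC-even o ns mx c
lemma3 j' k' _ o ns mx (inj₂ (inj₂ (inj₂ (inj₁ d))))     =
  subst (2 ∣_) (numUndirected-reverse o)
    (configB-even (reverse ∘ o) (noSinkNoSource-reverse ns) (maximal-reverse mx) (configD-reverse o d))
lemma3 j' k' _ o ns mx (inj₂ (inj₂ (inj₂ (inj₂ e))))     =
  subst (2 ∣_) (numUndirected-reverse o)
    (configC-even (reverse ∘ o) (noSinkNoSource-reverse ns) (maximal-reverse mx) (configE-reverse o e))
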